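{- Let $G$ be a graph with no isolated vertices, let $G_0,G_1,\dots,G_m$ be a minimal chain decomposition of $G$ rooted at $r$, and let $v\in V(G)$ with $v\ne r$. Then there are indices $i,j\in\{0,\dots,m\}$ such that $v$ has degree exactly two in $H_i$ and degree exactly two in $\overline{H_j}$.
   Context: Graphs are multigraphs (parallel edges and loops allowed; a loop adds $2$ to the degree; a loop is a cycle of length one and two parallel edges form a cycle of length two). Paths and cycles are simple. The degree of a vertex in a subgraph not containing it is $0$. An up chain of $G$ with respect to a pair of edge-disjoint subgraphs $(H,\overline{H})$ is a subgraph of $G$, edge-disjoint from $H$ and $\overline{H}$, which is either (i) a path with at least one edge such that every vertex is either $r$ or has degree at least two in $\overline{H}$, and each end is either $r$ or lies in $H$; or (ii) a cycle such that every vertex is either $r$ or has degree at least two in $\overline{H}$, and some vertex $v$ of it is either $r$ or has degree at least two in $H$ ($v$ is regarded as both ends, all other vertices internal). A down chain with respect to $(H,\overline{H})$ is an up chain with respect to $(\overline{H},H)$. A one-way chain with respect to $(H,\overline{H})$ is the subgraph induced by a single edge $e\notin E(H)\cup E(\overline{H})$ with ends $u$ (tail) and $v$ (head) such that $u$ is $r$ or has degree at least two in $H$, and $v$ is $r$ or has degree at least two in $\overline{H}$. A sequence $G_0,\dots,G_m$ of subgraphs of $G$ is a chain decomposition of $G$ rooted at $r\in V(G)$ if, writing $H_i=G_0\cup\cdots\cup G_{i-1}$ and $\overline{H_i}=G_{i+1}\cup\cdots\cup G_m$ (so $H_0$ and $\overline{H_m}$ are null), the sets $E(G_0),\dots,E(G_m)$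 partition $E(G)$ and each $G_i$ is an up chain, a down chain, or a one-way chain with respect to $(H_i,\overline{H_i})$. An up chain $G_i$ of the decomposition is minimal if no internal vertex of $G_i$ lies in $\{r\}\cup V(H_i)$; a down chain $G_i$ is minimal if no internal vertex of $G_i$ lies in $\{r\}\cup V(\overline{H_i})$. The chain decomposition is minimal if all of its up chains and down chains are minimal. -}

module Defs where

open import Data.Nat using (ℕ; zero; suc; _+_; _≤_; _<ᵇ_; NonZero)
open import Data.Nat.DivMod using (_%_; m%n<n)
open import Data.Fin using (Fin; zero; suc; toℕ; fromℕ<; inject₁; _≟_)
open import Data.Bool using (Bool; true; false; if_then_else_)
open import Data.Product using (_×_; _,_; proj₁; proj₂; ∃; ∃-syntax)
open import Data.Sum using (_⊎_)
open import Data.Unit using (⊤)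
open import Function.Bundles using (_⇔_)
open import Function.Definitions using (Injective)
open import Relation.Nullary using (¬_; does)
open import Relation.Binary.PropositionalEquality using (_≡_; _≢_)

-- A finite multigraph: vertices Fin nV, edges Fin nE, each edge has an
-- (unordered) pair of ends; loops (equal ends) and parallel edges allowed.
record Graph : Set where
  field
    nV    : ℕ
    nE    : ℕ
    ends  : Fin nE → Fin nV × Fin nV

module _ (g : Graph) where
  open Graph g

  V : Set
  V = Fin nV

  E : Set
  E = Fin nE

  Joins : E → V → V → Set
  Joins e u v = ends e ≡ (u , v) ⊎ ends e ≡ (v , u)

  IncidentTo : E → V → Set
  IncidentTo e v = proj₁ (ends e) ≡ v ⊎ proj₂ (ends e) ≡ v

  NoIsolated : Set
  NoIsolated = ∀ (v : V) → ∃[ e ] IncidentTo e v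

  -- A subgraph arising here (union of chains, none of which has isolated
  -- vertices) is determined by its edge set; its vertices are the ends of
  -- its edges.
  EdgeSet : Set
  EdgeSet = E → Bool

  mult : E → V → ℕ
  mult e v = (if does (proj₁ (ends e) ≟ v) then 1 else 0)
           + (if does (proj₂ (ends e) ≟ v) then 1 else 0)

  sumFin : (k : ℕ) → (Fin k → ℕ) → ℕ
  sumFin zero    f = 0
  sumFin (suc k) f = f zero + sumFin k (λ i → f (suc i))

  deg : EdgeSet → V → ℕ
  deg S v = sumFin nE (λ e → if S e then mult e v else 0)

  InV : EdgeSet → V → Set
  InV S v = ∃[ e ] (S e ≡ true × IncidentTo e v)

  next : ∀ {ℓ} → Fin (suc ℓ) → Fin (suc ℓ)
  next {ℓ} k = fromℕ< (m%n<n (suc (toℕ k)) (suc ℓ))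

  record PathOn (P : EdgeSet) : Set where
    field
      len     : ℕ
      len≥1   : 1 ≤ len
      vs      : Fin (suc len) → V
      vs-inj  : Injective _≡_ _≡_ vs
      es      : Fin len → E
      es-inj  : Injective _≡_ _≡_ es
      es-join : ∀ k → Joins (es k) (vs (inject₁ k)) (vs (suc k))
      exact   : ∀ e → (P e ≡ true) ⇔ (∃[ k ] es k ≡ e)

  -- a cycle of length suc ℓ whose edge set is exactly P:
  -- distinct vertices vs 0 , … , vs ℓ, edges es k joining vs k and vs (k+1 mod (suc ℓ));
  -- vs 0 is the designated vertex (regarded as both ends).
  record CycleOn (P : EdgeSet) : Set where
    field
      ℓ       : ℕ
      vs      : Fin (suc ℓ) → V
      vs-inj  : Injective _≡_ _≡_ vs
      es      : Fin (suc ℓ) → E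
      es-inj  : Injective _≡_ _≡_ es
      es-join : ∀ k → Joins (es k) (vs k) (vs (next k))
      exact   : ∀ e → (P e ≡ true) ⇔ (∃[ k ] es k ≡ e)

  module _ (r : V) where

    RootOrDeg2 : EdgeSet → V → Set
    RootOrDeg2 S v = v ≡ r ⊎ 2 ≤ deg S v

    RootOrIn : EdgeSet → V → Set
    RootOrIn S v = v ≡ r ⊎ InV S v

    -- up-chain conditions w.r.t. (A , B) = (H , H̄)
    UpPath : (A B : EdgeSet) {P : EdgeSet} → PathOn P → Set
    UpPath A B p = (∀ k → RootOrDeg2 B (vs k))
                 × RootOrIn A (vs zero) × RootOrIn A (vs (Data.Fin.fromℕ len))
      where open PathOn p

    UpCycle : (A B : EdgeSet) {P : EdgeSet} → CycleOn P → Set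
    UpCycle A B c = (∀ k → RootOrDeg2 B (vs k)) × RootOrDeg2 A (vs zero)
      where open CycleOn c

    OneWay : (A B : EdgeSet) → EdgeSet → Set
    OneWay A B P = ∃[ e ] ((∀ e' → (P e' ≡ true) ⇔ (e' ≡ e))
                 × ∃[ u ] ∃[ v ] (ends e ≡ (u , v) × RootOrDeg2 A u × RootOrDeg2 B v))

    MinPath : (A : EdgeSet) {P : EdgeSet} → PathOn P → Set
    MinPath A p = ∀ k → k ≢ zero → toℕ k ≢ len → ¬ RootOrIn A (vs k)
      where open PathOn p

    MinCycle : (A : EdgeSet) {P : EdgeSet} → CycleOn P → Set
    MinCycle A c = ∀ k → k ≢ zero → ¬ RootOrIn A (vs k)
      where open CycleOn c

    data Chain (A B P : EdgeSet) : Set where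
      upPath    : (p : PathOn P)  → UpPath A B p  → Chain A B P
      upCycle   : (c : CycleOn P) → UpCycle A B c → Chain A B P
      downPath  : (p : PathOn P)  → UpPath B A p  → Chain A B P
      downCycle : (c : CycleOn P) → UpCycle B A c → Chain A B P
      oneWay    : OneWay A B P → Chain A B P

    IsMinimalChain : {A B P : EdgeSet} → Chain A B P → Set
    IsMinimalChain {A} {B} (upPath p _)    = MinPath A p
    IsMinimalChain {A} {B} (upCycle c _)   = MinCycle A c
    IsMinimalChain {A} {B} (downPath p _)  = MinPath B p
    IsMinimalChain {A} {B} (downCycle c _) = MinCycle B c
    IsMinimalChain (oneWay _)              = ⊤

    -- A chain decomposition G_0 , … , G_m rooted at r: the partition of E(G)
    -- is given by assigning each edge the index of its part.
    record ChainDecomp : Set where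
      field
        m     : ℕ
        part  : E → Fin (suc m)

      Gi : Fin (suc m) → EdgeSet
      Gi i e = does (part e ≟ i)

      H : Fin (suc m) → EdgeSet
      H i e = toℕ (part e) <ᵇ toℕ i

      Hbar : Fin (suc m) → EdgeSet
      Hbar i e = toℕ i <ᵇ toℕ (part e)

      field
        chain : (i : Fin (suc m)) → Chain (H i) (Hbar i) (Gi i)

    IsMinimal : ChainDecomp → Set
    IsMinimal D = ∀ i → IsMinimalChain (chain i)
      where open ChainDecomp D

-- Fix v ≠ r and write a, p, b for the degrees of v in H_i, G_i, H̄_i.  Every chain of a
-- minimal decomposition satisfies a = 0 ⇒ p ≤ 2, a = 1 ⇒ p ≤ 1 and (p > 0 ∧ a ≤ 1) ⇒ b ≥ 2,
-- and the same with H_i and H̄_i exchanged: vertices of an up chain are heavy in H̄_i and,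
-- by minimality, meet H_i only at its ends; vertices of a down chain are heavy in H_i; a
-- one-way edge has its tail heavy in H_i and its head heavy in H̄_i.  So deg_{H_i} v, which
-- starts at 0 and grows by p, cannot jump over 2.  Were it ≤ 1 throughout, v would have total
-- degree ≤ 1, yet the chain containing an edge at v would make v heavy in its H̄_i.  The
-- exchanged conditions give the claim for H̄_j by reading the decomposition backwards.

module Submission where

open import Defs
open import Data.Nat using (ℕ; zero; suc; _+_; _∸_; _≤_; _<_; z≤n; s≤s; s≤s⁻¹; z<s; _<ᵇ_; _≡ᵇ_)
open import Data.Nat.Properties
  using ( ≤-refl; ≤-trans; ≤-reflexive; ≤-antisym; <⇒≤; ≤⇒≯; ≮⇒≥; n≤0⇒n≡0; m≤n⇒m<n∨m≡n; _<?_
        ; +-assoc; +-comm; +-identityʳ; +-cancelˡ-≡; +-mono-≤; m≤m+n; m≤n+m; 1+n≢n; <ᵇ⇒<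
        ; m∸n≤m; +-∸-assoc; n∸n≡0; m∸[m∸n]≡n; +-commutativeSemigroup; module ≤-Reasoning )
import Data.Nat.Properties as ℕ
open import Data.Nat.DivMod using (_%_; m<n⇒m%n≡m; n%n≡0)
open import Data.Fin using (Fin; zero; suc; toℕ; fromℕ; fromℕ<; inject₁; _≟_)
open import Data.Fin.Properties
  using (suc-injective; inject₁-injective; toℕ-inject₁; toℕ-injective; toℕ-fromℕ; toℕ-fromℕ<; toℕ≤pred[n]; fromℕ≢inject₁)
open import Data.Bool using (true; false; if_then_else_; T)
open import Data.Unit using (tt)
open import Data.Product using (_×_; _,_; proj₁; proj₂; ∃-syntax; swap)
open import Data.Sum using (_⊎_; inj₁; inj₂; [_,_]) renaming (swap to ⊎-swap)
open import Data.Empty using (⊥-elim)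
open import Function using (_∘_; case_of_)
open import Function.Bundles using (Equivalence; _⇔_)
open import Function.Definitions using (Injective)
open import Relation.Nullary using (does; yes; no)
open import Relation.Nullary.Decidable using (dec-true)
open import Relation.Binary.PropositionalEquality
  using (_≡_; _≢_; refl; sym; trans; cong; cong₂; subst; module ≡-Reasoning)
open import Algebra.Properties.CommutativeSemigroup +-commutativeSemigroup using (interchange; xy∙z≈zy∙x)

record Admissible (a p b : ℕ) : Set where
  field
    fresh   : a ≡ 0 → p ≤ 2
    once    : a ≡ 1 → p ≤ 1
    handOff : 0 < p → a ≤ 1 → 2 ≤ b

  light-step : a ≤ 1 → a + p ≤ 1 ⊎ a + p ≡ 2
  light-step z≤n with m≤n⇒m<n∨m≡n (fresh refl)
  ... | inj₁ p<2 = inj₁ (s≤s⁻¹ p<2)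
  ... | inj₂ p≡2 = inj₂ p≡2
  light-step (s≤s z≤n) with once refl
  ... | z≤n     = inj₁ ≤-refl
  ... | s≤s z≤n = inj₂ refl

-- before n, at n, after n: the degrees of v in H_n, G_n, H̄_n.
record Profile (m : ℕ) : Set where
  field
    before at after : ℕ → ℕ
    total       : ℕ
    split       : ∀ {n} → n ≤ m → total ≡ before n + at n + after n
    before-zero : before 0 ≡ 0
    before-suc  : ∀ {n} → n < m → before (suc n) ≡ before n + at n
    after-last  : after m ≡ 0

  after-suc : ∀ {n} → n < m → after n ≡ at (suc n) + after (suc n)
  after-suc {n} n<m = +-cancelˡ-≡ (before n + at n) _ _ (begin
    before n + at n + after n                       ≡⟨ split (<⇒≤ n<m) ⟨
    total                                           ≡⟨ split n<m ⟩
    before (suc n) + at (suc n) + after (suc n)     ≡⟨ cong (λ x → x + at (suc n) + after (suc n)) (before-suc n<m) ⟩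
    before n + at n + at (suc n) + after (suc n)    ≡⟨ +-assoc (before n + at n) _ _ ⟩
    before n + at n + (at (suc n) + after (suc n))  ∎)
    where open ≡-Reasoning

  Forward : Set
  Forward = ∀ {n} → n ≤ m → Admissible (before n) (at n) (after n)

  Backward : Set
  Backward = ∀ {n} → n ≤ m → Admissible (after n) (at n) (before n)

  Occupied : Set
  Occupied = ∃[ n ] (n ≤ m × 0 < at n)

  light-or-two : Forward → ∀ {n} → n ≤ m → before n ≤ 1 ⊎ ∃[ k ] (k ≤ m × before k ≡ 2)
  light-or-two adm {zero}  _   = inj₁ (≤-trans (≤-reflexive before-zero) z≤n)
  light-or-two adm {suc n} n<m with light-or-two adm (<⇒≤ n<m)
  ... | inj₂ two   = inj₂ two
  ... | inj₁ light with Admissible.light-step (adm (<⇒≤ n<m)) light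
  ... | inj₁ light′ = inj₁ (≤-trans (≤-reflexive (before-suc n<m)) light′)
  ... | inj₂ two    = inj₂ (suc n , n<m , trans (before-suc n<m) two)

  total-light : Forward → before m ≤ 1 → total ≤ 1
  total-light adm light = ≤-trans (≤-reflexive (begin
    total                          ≡⟨ split ≤-refl ⟩
    before m + at m + after m      ≡⟨ cong₂ (λ x y → before m + x + y) at-last after-last ⟩
    before m + 0 + 0               ≡⟨ cong (_+ 0) (+-identityʳ (before m)) ⟩
    before m + 0                   ≡⟨ +-identityʳ (before m) ⟩
    before m                       ∎)) light
    where
    open ≡-Reasoning
    at-last : at m ≡ 0
    at-last = n≤0⇒n≡0 (≮⇒≥ λ touched →
      ≤⇒≯ z≤n (subst (2 ≤_) after-last (Admissible.handOff (adm ≤-refl) touched light)))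

  before≤total : ∀ {n} → n ≤ m → before n ≤ total
  before≤total {n} n≤m =
    ≤-trans (≤-trans (m≤m+n (before n) (at n)) (m≤m+n _ (after n))) (≤-reflexive (sym (split n≤m)))

  after≤total : ∀ {n} → n ≤ m → after n ≤ total
  after≤total {n} n≤m = ≤-trans (m≤n+m (after n) _) (≤-reflexive (sym (split n≤m)))

  reaches-two : Forward → Occupied → ∃[ n ] (n ≤ m × before n ≡ 2)
  reaches-two adm (n , n≤m , touched) with light-or-two adm ≤-refl
  ... | inj₂ two   = two
  ... | inj₁ light = ⊥-elim (≤⇒≯ (≤-trans (after≤total n≤m) total≤1)
                                 (Admissible.handOff (adm n≤m) touched (≤-trans (before≤total n≤m) total≤1)))
    where
    total≤1 : total ≤ 1
    total≤1 = total-light adm light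

-- Reversing a chain decomposition does not give one in this encoding (one-way edges are
-- oriented by ends), so only the degree profile is reversed.
reverse : ∀ {m} → Profile m → Profile m
reverse {m} π = record
  { before      = λ n → after (m ∸ n)
  ; at          = λ n → at (m ∸ n)
  ; after       = λ n → before (m ∸ n)
  ; total       = total
  ; split       = λ {n} _ → trans (split (m∸n≤m m n)) (xy∙z≈zy∙x _ _ (after (m ∸ n)))
  ; before-zero = after-last
  ; before-suc  = λ {n} n<m → begin
      after (m ∸ suc n)                              ≡⟨ after-suc (subst (_≤ m) (m∸n≡1+m∸1+n n<m) (m∸n≤m m n)) ⟩
      at (suc (m ∸ suc n)) + after (suc (m ∸ suc n)) ≡⟨ +-comm (at (suc (m ∸ suc n))) _ ⟩
      after (suc (m ∸ suc n)) + at (suc (m ∸ suc n)) ≡⟨ cong (λ k → after k + at k) (m∸n≡1+m∸1+n n<m) ⟨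
      after (m ∸ n) + at (m ∸ n)                     ∎
  ; after-last  = trans (cong before (n∸n≡0 m)) before-zero
  }
  where
  open Profile π
  open ≡-Reasoning
  m∸n≡1+m∸1+n : ∀ {n} → n < m → m ∸ n ≡ suc (m ∸ suc n)
  m∸n≡1+m∸1+n = +-∸-assoc 1

module _ {m} (π : Profile m) where
  open Profile π

  leaves-two : Backward → Occupied → ∃[ n ] (n ≤ m × after n ≡ 2)
  leaves-two adm (n , n≤m , touched) with
    Profile.reaches-two (reverse π) (λ {k} _ → adm (m∸n≤m m k))
      (m ∸ n , m∸n≤m m n , subst (λ k → 0 < at k) (sym (m∸[m∸n]≡n n≤m)) touched)
  ... | k , _ , two = m ∸ k , m∸n≤m m k , two

heavy⇒admissible : ∀ {a p b} → (0 < p → 2 ≤ b) → Admissible b p a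
heavy⇒admissible {p = p} {b} heavy = record
  { fresh   = λ b≡0 → ≤-trans (untouched (≤-trans (≤-reflexive b≡0) z≤n)) z≤n
  ; once    = λ b≡1 → ≤-trans (untouched (≤-reflexive b≡1)) z≤n
  ; handOff = λ pos b≤1 → ⊥-elim (≤⇒≯ b≤1 (heavy pos))
  }
  where
  untouched : b ≤ 1 → p ≤ 0
  untouched b≤1 = ≮⇒≥ λ pos → ≤⇒≯ b≤1 (heavy pos)

AtMostOne : {A : Set} → (A → Set) → Set
AtMostOne Q = ∀ {x y} → Q x → Q y → x ≡ y

AtMostOne-suc : ∀ {k} {Q : Fin (suc k) → Set} → AtMostOne Q → AtMostOne (Q ∘ suc)
AtMostOne-suc amo qx qy = suc-injective (amo qx qy)

Injective⇒AtMostOne : ∀ {A B : Set} {f : A → B} {y} →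
  Injective _≡_ _≡_ f → AtMostOne (λ x → f x ≡ y)
Injective⇒AtMostOne inj fx≡y fx′≡y = inj (trans fx≡y (sym fx′≡y))

inject₁≢suc : ∀ {n} (i : Fin n) → inject₁ i ≢ suc i
inject₁≢suc i eq = 1+n≢n (sym (trans (sym (toℕ-inject₁ i)) (cong toℕ eq)))

<ᵇ-false : ∀ {m n} → n ≤ m → (m <ᵇ n) ≡ false
<ᵇ-false {m} {n} n≤m with m <ᵇ n in eq
... | false = refl
... | true  = ⊥-elim (≤⇒≯ n≤m (<ᵇ⇒< m n (subst T (sym eq) tt)))

does-≟ : ∀ {k} (i j : Fin k) → does (i ≟ j) ≡ (toℕ i ≡ᵇ toℕ j)
does-≟ zero    zero    = refl
does-≟ zero    (suc j) = refl
does-≟ (suc i) zero    = refl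
does-≟ (suc i) (suc j) = does-≟ i j

if-<ᵇ-suc : ∀ p n x →
  (if p <ᵇ suc n then x else 0) ≡ (if p <ᵇ n then x else 0) + (if p ≡ᵇ n then x else 0)
if-<ᵇ-suc zero    zero    x = refl
if-<ᵇ-suc zero    (suc n) x = sym (+-identityʳ x)
if-<ᵇ-suc (suc p) zero    x = refl
if-<ᵇ-suc (suc p) (suc n) x = if-<ᵇ-suc p n x

if-<ᵇ-suc-or-> : ∀ p n x → x ≡ (if p <ᵇ suc n then x else 0) + (if n <ᵇ p then x else 0)
if-<ᵇ-suc-or-> zero    n       x = sym (+-identityʳ x)
if-<ᵇ-suc-or-> (suc p) zero    x = refl
if-<ᵇ-suc-or-> (suc p) (suc n) x = if-<ᵇ-suc-or-> p n x

∀≤-fromFin : ∀ {m} {Q : ℕ → Set} → (∀ (i : Fin (suc m)) → Q (toℕ i)) → ∀ {n} → n ≤ m → Q n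
∀≤-fromFin {Q = Q} f n≤m = subst Q (toℕ-fromℕ< (s≤s n≤m)) (f (fromℕ< (s≤s n≤m)))

∃≤-toFin : ∀ {m} {Q : ℕ → Set} → ∃[ n ] (n ≤ m × Q n) → ∃[ i ] Q (toℕ {suc m} i)
∃≤-toFin {Q = Q} (n , n≤m , q) = fromℕ< (s≤s n≤m) , subst Q (sym (toℕ-fromℕ< (s≤s n≤m))) q

module _ (g : Graph) where
  open Graph g

  sumFin-cong : ∀ {k} {f h : Fin k → ℕ} → (∀ i → f i ≡ h i) → sumFin g k f ≡ sumFin g k h
  sumFin-cong {zero}  eq = refl
  sumFin-cong {suc k} eq = cong₂ _+_ (eq zero) (sumFin-cong (eq ∘ suc))

  sumFin-+ : ∀ {k} (f h : Fin k → ℕ) →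
    sumFin g k (λ i → f i + h i) ≡ sumFin g k f + sumFin g k h
  sumFin-+ {zero}  f h = refl
  sumFin-+ {suc k} f h = trans (cong (f zero + h zero +_) (sumFin-+ (f ∘ suc) (h ∘ suc)))
                               (interchange (f zero) (h zero) _ _)

  sumFin-zero : ∀ {k} {f : Fin k → ℕ} → (∀ i → f i ≡ 0) → sumFin g k f ≡ 0
  sumFin-zero {zero}  z = refl
  sumFin-zero {suc k} z = cong₂ _+_ (z zero) (sumFin-zero (z ∘ suc))

  sumFin-pos : ∀ {k} (f : Fin k → ℕ) → 0 < sumFin g k f → ∃[ i ] 0 < f i
  sumFin-pos {suc k} f pos with f zero in f₀
  ... | suc _ = zero , subst (0 <_) (sym f₀) z<s
  ... | zero with sumFin-pos (f ∘ suc) pos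
  ...   | i , fi = suc i , fi

  term≤sumFin : ∀ {k} (f : Fin k → ℕ) i → f i ≤ sumFin g k f
  term≤sumFin f zero    = m≤m+n _ _
  term≤sumFin f (suc i) = ≤-trans (term≤sumFin (f ∘ suc) i) (m≤n+m _ _)

  sumFin≤-support₁ : ∀ {k} {f : Fin k → ℕ} {c} {Q : Fin k → Set} → AtMostOne Q →
    (∀ i → f i ≤ c) → (∀ i → 0 < f i → Q i) → sumFin g k f ≤ c
  sumFin≤-support₁ {zero}            amo bound supp = z≤n
  sumFin≤-support₁ {suc k} {f} {c} {Q} amo bound supp with f zero in f₀
  ... | zero  = sumFin≤-support₁ (AtMostOne-suc amo) (bound ∘ suc) (supp ∘ suc)
  ... | suc x = begin
    suc x + sumFin g k (f ∘ suc) ≡⟨ cong (suc x +_) (sumFin-zero rest-zero) ⟩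
    suc x + 0                    ≡⟨ +-identityʳ (suc x) ⟩
    suc x                        ≡⟨ f₀ ⟨
    f zero                       ≤⟨ bound zero ⟩
    c                            ∎
    where
    open ≤-Reasoning
    rest-zero : ∀ i → f (suc i) ≡ 0
    rest-zero i = n≤0⇒n≡0 (≮⇒≥ λ pos →
      case amo (supp zero (subst (0 <_) (sym f₀) z<s)) (supp (suc i) pos) of λ ())

  private
    remaining-support : ∀ {k} {f : Fin (suc k) → ℕ} {R S : Fin (suc k) → Set} → AtMostOne R → R zero →
      (∀ i → 0 < f i → R i ⊎ S i) → ∀ i → 0 < f (suc i) → S (suc i)
    remaining-support amo r₀ supp i pos =
      [ (λ rᵢ → case amo r₀ rᵢ of λ ()) , (λ sᵢ → sᵢ) ] (supp (suc i) pos)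

  sumFin≤-support₂ : ∀ {k} {f : Fin k → ℕ} {Q₁ Q₂ : Fin k → Set} → AtMostOne Q₁ → AtMostOne Q₂ →
    (∀ i → f i ≤ 1) → (∀ i → 0 < f i → Q₁ i ⊎ Q₂ i) → sumFin g k f ≤ 2
  sumFin≤-support₂ {zero} _ _ _ _ = z≤n
  sumFin≤-support₂ {suc k} {f} a₁ a₂ bound supp with f zero in f₀ | bound zero
  ... | zero        | _      = sumFin≤-support₂ (AtMostOne-suc a₁) (AtMostOne-suc a₂) (bound ∘ suc) (supp ∘ suc)
  ... | suc (suc _) | s≤s ()
  ... | suc zero    | _ with supp zero (subst (0 <_) (sym f₀) z<s)
  ...   | inj₁ q₁ = s≤s (sumFin≤-support₁ (AtMostOne-suc a₂) (bound ∘ suc)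
                          (remaining-support a₁ q₁ supp))
  ...   | inj₂ q₂ = s≤s (sumFin≤-support₁ (AtMostOne-suc a₁) (bound ∘ suc)
                          (remaining-support a₂ q₂ (λ i → ⊎-swap ∘ supp i)))

  -- mult g e v unfolds to hits (proj₁ (ends e)) v + hits (proj₂ (ends e)) v.
  hits : V g → V g → ℕ
  hits x v = if does (x ≟ v) then 1 else 0

  hits≤1 : ∀ x v → hits x v ≤ 1
  hits≤1 x v with x ≟ v
  ... | yes _ = ≤-refl
  ... | no _  = z≤n

  hits-self : ∀ v → hits v v ≡ 1
  hits-self v rewrite dec-true (v ≟ v) refl = refl

  hits-≢ : ∀ {x v} → x ≢ v → hits x v ≡ 0
  hits-≢ {x} {v} x≢v with x ≟ v
  ... | yes x≡v = ⊥-elim (x≢v x≡v)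
  ... | no _    = refl

  hits-+≤1 : ∀ {a b v} → (a ≡ v → b ≢ v) → hits a v + hits b v ≤ 1
  hits-+≤1 {a} {b} {v} ¬both with a ≟ v
  ... | yes a≡v = ≤-reflexive (cong suc (hits-≢ (¬both a≡v)))
  ... | no _    = hits≤1 b v

  hits-+-pos : ∀ {a b v} → 0 < hits a v + hits b v → a ≡ v ⊎ b ≡ v
  hits-+-pos {a} {b} {v} pos with a ≟ v | b ≟ v
  ... | yes a≡v | _       = inj₁ a≡v
  ... | no _    | yes b≡v = inj₂ b≡v

  hits-+-pos⁻ : ∀ {a b v} → a ≡ v ⊎ b ≡ v → 0 < hits a v + hits b v
  hits-+-pos⁻ {b = b} {v}     (inj₁ refl) = ≤-trans (≤-reflexive (sym (hits-self v))) (m≤m+n _ (hits b v))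
  hits-+-pos⁻ {a = a} {v = v} (inj₂ refl) = ≤-trans (≤-reflexive (sym (hits-self v))) (m≤n+m _ (hits a v))

  mult-joins : ∀ {e a b v} → Joins g e a b → mult g e v ≡ hits a v + hits b v
  mult-joins (inj₁ eq) rewrite eq = refl
  mult-joins {a = a} {b} {v} (inj₂ eq) rewrite eq = +-comm (hits b v) (hits a v)

  joins-incident : ∀ {e a b v} → Joins g e a b → IncidentTo g e v → a ≡ v ⊎ b ≡ v
  joins-incident ab inc = hits-+-pos (subst (0 <_) (mult-joins ab) (hits-+-pos⁻ inc))

  degTerm : EdgeSet g → V g → E g → ℕ
  degTerm S v e = if S e then mult g e v else 0

  deg-cong : ∀ {S S′} v → (∀ e → S e ≡ S′ e) → deg g S v ≡ deg g S′ v
  deg-cong v eq = sumFin-cong (λ e → cong (λ b → if b then mult g e v else 0) (eq e))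

  degTerm-pos : ∀ S v e → 0 < degTerm S v e → S e ≡ true × IncidentTo g e v
  degTerm-pos S v e pos with S e
  ... | true = refl , hits-+-pos pos

  deg-pos⇒InV : ∀ S v → 0 < deg g S v → InV g S v
  deg-pos⇒InV S v pos with sumFin-pos (degTerm S v) pos
  ... | e , term = e , degTerm-pos S v e term

  InV⇒deg-pos : ∀ S v → InV g S v → 0 < deg g S v
  InV⇒deg-pos S v (e , Se , inc) = ≤-trans
    (subst (λ b → 0 < (if b then mult g e v else 0)) (sym Se) (hits-+-pos⁻ inc))
    (term≤sumFin (degTerm S v) e)

  -- The common shape of PathOn (src = inject₁, tgt = suc) and CycleOn (src = id, tgt = next).
  record Traversal (P : EdgeSet g) : Set where
    field
      points steps : ℕ
      vs       : Fin points → V g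
      vs-inj   : Injective _≡_ _≡_ vs
      es       : Fin steps → E g
      src tgt  : Fin steps → Fin points
      es-joins : ∀ i → Joins g (es i) (vs (src i)) (vs (tgt i))
      covers   : ∀ e → P e ≡ true → ∃[ i ] es i ≡ e

    opposite : Traversal P
    opposite = record
      { vs = vs ; vs-inj = vs-inj ; es = es ; src = tgt ; tgt = src
      ; es-joins = λ i → ⊎-swap (es-joins i) ; covers = covers }

    edge-at : ∀ {v e} → 0 < degTerm P v e → ∃[ i ] (es i ≡ e × (vs (src i) ≡ v ⊎ vs (tgt i) ≡ v))
    edge-at {v} {e} pos with degTerm-pos P v e pos
    ... | Pe , inc with covers e Pe
    ...   | i , refl = i , refl , joins-incident (es-joins i) inc

    vertex-of : ∀ {v} → 0 < deg g P v → ∃[ j ] vs j ≡ v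
    vertex-of {v} pos with edge-at (proj₂ (sumFin-pos (degTerm P v) pos))
    ... | i , _ , inj₁ at-src = src i , at-src
    ... | i , _ , inj₂ at-tgt = tgt i , at-tgt

    private
      Through : (Fin steps → Fin points) → Fin points → E g → Set
      Through end j e = ∃[ i ] (es i ≡ e × end i ≡ j)

      Through-atMostOne : ∀ {end j} → AtMostOne (λ i → end i ≡ j) → AtMostOne (Through end j)
      Through-atMostOne amo (i , refl , eᵢ) (i′ , refl , eᵢ′) = cong es (amo eᵢ eᵢ′)

      term-support : ∀ j e → 0 < degTerm P (vs j) e → Through src j e ⊎ Through tgt j e
      term-support j e pos with edge-at pos
      ... | i , eᵢ , inj₁ at-src = inj₁ (i , eᵢ , vs-inj at-src)
      ... | i , eᵢ , inj₂ at-tgt = inj₂ (i , eᵢ , vs-inj at-tgt)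

      term≤1 : ∀ j → (∀ i → src i ≡ j → tgt i ≢ j) → ∀ e → degTerm P (vs j) e ≤ 1
      term≤1 j no-loop e with P e in Pe
      ... | false = z≤n
      ... | true with covers e Pe
      ...   | i , refl = ≤-trans (≤-reflexive (mult-joins (es-joins i)))
                                 (hits-+≤1 λ s≡ t≡ → no-loop i (vs-inj s≡) (vs-inj t≡))

    deg≤2 : ∀ j → AtMostOne (λ i → src i ≡ j) → AtMostOne (λ i → tgt i ≡ j) →
      (∀ i → src i ≡ j → tgt i ≢ j) → deg g P (vs j) ≤ 2
    deg≤2 j src-amo tgt-amo no-loop =
      sumFin≤-support₂ (Through-atMostOne src-amo) (Through-atMostOne tgt-amo) (term≤1 j no-loop) (term-support j)

    deg≤1 : ∀ j → AtMostOne (λ i → src i ≡ j) → (∀ i → tgt i ≢ j) → deg g P (vs j) ≤ 1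
    deg≤1 j src-amo never-tgt = sumFin≤-support₁ (Through-atMostOne src-amo) (term≤1 j (λ i _ → never-tgt i))
      λ e pos → [ (λ s → s) , (λ { (i , _ , t≡j) → ⊥-elim (never-tgt i t≡j) }) ] (term-support j e pos)

    deg≤-at : ∀ {c v} → (∀ j → vs j ≡ v → deg g P (vs j) ≤ c) → deg g P v ≤ c
    deg≤-at {v = v} bound with 0 <? deg g P v
    ... | no ¬pos = ≤-trans (≮⇒≥ ¬pos) z≤n
    ... | yes pos with vertex-of pos
    ...   | j , refl = bound j refl

  module Path {P : EdgeSet g} (p : PathOn g P) where
    open PathOn p

    traversal : Traversal P
    traversal = record
      { vs = vs ; vs-inj = vs-inj ; es = es ; src = inject₁ ; tgt = suc
      ; es-joins = es-join ; covers = λ e → Equivalence.to (exact e) }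

    open Traversal traversal using (vertex-of; deg≤-at)

    start-deg≤1 : deg g P (vs zero) ≤ 1
    start-deg≤1 = Traversal.deg≤1 traversal zero (Injective⇒AtMostOne inject₁-injective) (λ _ ())

    end-deg≤1 : deg g P (vs (fromℕ len)) ≤ 1
    end-deg≤1 = Traversal.deg≤1 (Traversal.opposite traversal) (fromℕ len)
      (Injective⇒AtMostOne suc-injective) (λ _ → fromℕ≢inject₁ ∘ sym)

    deg≤2 : ∀ v → deg g P v ≤ 2
    deg≤2 v = deg≤-at λ j _ → Traversal.deg≤2 traversal j
      (Injective⇒AtMostOne inject₁-injective) (Injective⇒AtMostOne suc-injective)
      (λ i s≡j t≡j → inject₁≢suc i (trans s≡j (sym t≡j)))

    internal-of-deg≥2 : ∀ {v} → 2 ≤ deg g P v → ∃[ k ] (k ≢ zero × toℕ k ≢ len × vs k ≡ v)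
    internal-of-deg≥2 two with vertex-of (≤-trans (s≤s z≤n) two)
    ... | k , refl = k , not-start , not-end , refl
      where
      not-start : k ≢ zero
      not-start refl = ≤⇒≯ start-deg≤1 two
      not-end : toℕ k ≢ len
      not-end k≡len = ≤⇒≯ (subst (λ j → deg g P (vs j) ≤ 1) k≡end end-deg≤1) two
        where
        k≡end : fromℕ len ≡ k
        k≡end = toℕ-injective (trans (toℕ-fromℕ len) (sym k≡len))

  toℕ-next : ∀ {ℓ} {i k : Fin (suc ℓ)} → next g i ≡ k → k ≢ zero → toℕ k ≡ suc (toℕ i)
  toℕ-next {ℓ} {i} refl next≢0 with m≤n⇒m<n∨m≡n (toℕ≤pred[n] i)
  ... | inj₁ i<ℓ = trans (toℕ-fromℕ< _) (m<n⇒m%n≡m (s≤s i<ℓ))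
  ... | inj₂ i≡ℓ = ⊥-elim (next≢0 (toℕ-injective (begin
    toℕ (next g i)       ≡⟨ toℕ-fromℕ< _ ⟩
    suc (toℕ i) % suc ℓ  ≡⟨ cong (λ x → suc x % suc ℓ) i≡ℓ ⟩
    suc ℓ % suc ℓ        ≡⟨ n%n≡0 (suc ℓ) ⟩
    0                    ∎)))
    where open ≡-Reasoning

  module Cycle {P : EdgeSet g} (c : CycleOn g P) where
    open CycleOn c

    traversal : Traversal P
    traversal = record
      { vs = vs ; vs-inj = vs-inj ; es = es ; src = λ i → i ; tgt = next g
      ; es-joins = es-join ; covers = λ e → Equivalence.to (exact e) }

    open Traversal traversal using (vertex-of; deg≤-at) public

    deg≤2 : ∀ {k} → k ≢ zero → deg g P (vs k) ≤ 2
    deg≤2 {k} k≢0 = Traversal.deg≤2 traversal k (λ i≡k i′≡k → trans i≡k (sym i′≡k)) next-amo no-loop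
      where
      next-amo : AtMostOne (λ i → next g i ≡ k)
      next-amo i↦k i′↦k =
        toℕ-injective (ℕ.suc-injective (trans (sym (toℕ-next i↦k k≢0)) (toℕ-next i′↦k k≢0)))
      no-loop : ∀ i → i ≡ k → next g i ≢ k
      no-loop i refl i↦i = 1+n≢n (sym (toℕ-next i↦i k≢0))

  deg-single : ∀ {P e} v → (∀ e′ → (P e′ ≡ true) ⇔ (e′ ≡ e)) → deg g P v ≡ mult g e v
  deg-single {P} {e} v exact = ≤-antisym
    (sumFin≤-support₁ (λ e₁≡e e₂≡e → trans e₁≡e (sym e₂≡e)) term≤
      (λ e′ pos → Equivalence.to (exact e′) (proj₁ (degTerm-pos P v e′ pos))))
    (subst (λ b → (if b then mult g e v else 0) ≤ deg g P v) (Equivalence.from (exact e) refl)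
      (term≤sumFin (degTerm P v) e))
    where
    term≤ : ∀ e′ → degTerm P v e′ ≤ mult g e v
    term≤ e′ with P e′ in Pe′
    ... | false = z≤n
    ... | true rewrite Equivalence.to (exact e′) Pe′ = ≤-refl

  oneWay-admissible : ∀ {a b u w v} → (u ≡ v → 2 ≤ a) → (w ≡ v → 2 ≤ b) →
    Admissible a (hits u v + hits w v) b
  oneWay-admissible {a} {b} {u} {w} {v} tail-heavy head-heavy = record
    { fresh   = λ _ → +-mono-≤ (hits≤1 u v) (hits≤1 w v)
    ; once    = λ a≡1 → hits-+≤1 {b = w} λ u≡v → ⊥-elim (not-tail (≤-reflexive a≡1) u≡v)
    ; handOff = λ pos a≤1 → [ (λ u≡v → ⊥-elim (not-tail a≤1 u≡v)) , head-heavy ] (hits-+-pos pos)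
    }
    where
    not-tail : a ≤ 1 → u ≢ v
    not-tail a≤1 u≡v = ≤⇒≯ a≤1 (tail-heavy u≡v)

  Balanced : V g → (A B P : EdgeSet g) → Set
  Balanced v A B P =
    Admissible (deg g A v) (deg g P v) (deg g B v) × Admissible (deg g B v) (deg g P v) (deg g A v)

  deg-partition : ∀ {S S₁ S₂} v → (∀ e → degTerm S v e ≡ degTerm S₁ v e + degTerm S₂ v e) →
    deg g S v ≡ deg g S₁ v + deg g S₂ v
  deg-partition {S₁ = S₁} {S₂} v split =
    trans (sumFin-cong split) (sumFin-+ (degTerm S₁ v) (degTerm S₂ v))

module _ (g : Graph) (r : V g) (v : V g) (v≢r : v ≢ r) where

  RootOrDeg2⇒heavy : ∀ {S x} → x ≡ v → RootOrDeg2 g r S x → 2 ≤ deg g S v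
  RootOrDeg2⇒heavy refl (inj₁ v≡r) = ⊥-elim (v≢r v≡r)
  RootOrDeg2⇒heavy refl (inj₂ two) = two

  positive⇒RootOrIn : ∀ {S x} → x ≡ v → 0 < deg g S v → RootOrIn g r S x
  positive⇒RootOrIn refl pos = inj₂ (deg-pos⇒InV g _ v pos)

  heavy-along : ∀ {P B} (t : Traversal g P) → (∀ j → RootOrDeg2 g r B (Traversal.vs t j)) →
    0 < deg g P v → 2 ≤ deg g B v
  heavy-along t all-heavy pos with Traversal.vertex-of t pos
  ... | j , vⱼ≡v = RootOrDeg2⇒heavy vⱼ≡v (all-heavy j)

  upPath-balanced : ∀ {A B P} (p : PathOn g P) → UpPath g r A B p → MinPath g r A p →
    Balanced g v A B P
  upPath-balanced {A} {B} {P} p (all-heavy , _) minimal = near , heavy⇒admissible on-heavy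
    where
    on-heavy : 0 < deg g P v → 2 ≤ deg g B v
    on-heavy = heavy-along (Path.traversal g p) all-heavy
    near : Admissible (deg g A v) (deg g P v) (deg g B v)
    near = record
      { fresh   = λ _ → Path.deg≤2 g p v
      ; once    = λ a≡1 → ≮⇒≥ λ two → case Path.internal-of-deg≥2 g p two of λ
          { (k , k≢0 , k≢len , vₖ≡v) →
              minimal k k≢0 k≢len (positive⇒RootOrIn vₖ≡v (≤-reflexive (sym a≡1))) }
      ; handOff = λ pos _ → on-heavy pos
      }

  upCycle-balanced : ∀ {A B P} (c : CycleOn g P) → UpCycle g r A B c → MinCycle g r A c →
    Balanced g v A B P
  upCycle-balanced {A} {B} {P} c (all-heavy , base-heavy) minimal = near , heavy⇒admissible on-heavy
    where
    open CycleOn c using (vs)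
    on-heavy : 0 < deg g P v → 2 ≤ deg g B v
    on-heavy = heavy-along (Cycle.traversal g c) all-heavy
    off-base : deg g A v ≤ 1 → 0 < deg g P v → ∃[ k ] (k ≢ zero × vs k ≡ v)
    off-base a≤1 pos with Cycle.vertex-of g c pos
    ... | zero  , v₀≡v = ⊥-elim (≤⇒≯ a≤1 (RootOrDeg2⇒heavy v₀≡v base-heavy))
    ... | suc k , vₖ≡v = suc k , (λ ()) , vₖ≡v
    near : Admissible (deg g A v) (deg g P v) (deg g B v)
    near = record
      { fresh   = λ a≡0 → Cycle.deg≤-at g c λ
          { zero v₀≡v → ⊥-elim (≤⇒≯ (≤-trans (≤-reflexive a≡0) z≤n) (RootOrDeg2⇒heavy v₀≡v base-heavy))
          ; (suc k) _ → Cycle.deg≤2 g c (λ ()) }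
      ; once    = λ a≡1 → ≮⇒≥ λ two → case off-base (≤-reflexive a≡1) (≤-trans (s≤s z≤n) two) of λ
          { (k , k≢0 , vₖ≡v) → minimal k k≢0 (positive⇒RootOrIn vₖ≡v (≤-reflexive (sym a≡1))) }
      ; handOff = λ pos _ → on-heavy pos
      }

  oneWay-balanced : ∀ {A B P} → OneWay g r A B P → Balanced g v A B P
  oneWay-balanced {A} {B} {P} (e , exact , u , w , ends≡ , tail-heavy , head-heavy) =
    subst (λ p → Admissible (deg g A v) p (deg g B v)) (sym deg≡) forward ,
    subst (λ p → Admissible (deg g B v) p (deg g A v)) (sym (trans deg≡ (+-comm (hits g u v) _)))
      backward
    where
    deg≡ : deg g P v ≡ hits g u v + hits g w v
    deg≡ = trans (deg-single g v exact) (mult-joins g (inj₁ ends≡))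
    forward : Admissible (deg g A v) (hits g u v + hits g w v) (deg g B v)
    forward = oneWay-admissible g (λ u≡v → RootOrDeg2⇒heavy u≡v tail-heavy)
                                  (λ w≡v → RootOrDeg2⇒heavy w≡v head-heavy)
    backward : Admissible (deg g B v) (hits g w v + hits g u v) (deg g A v)
    backward = oneWay-admissible g (λ w≡v → RootOrDeg2⇒heavy w≡v head-heavy)
                                   (λ u≡v → RootOrDeg2⇒heavy u≡v tail-heavy)

  chain-balanced : ∀ {A B P} (c : Chain g r A B P) → IsMinimalChain g r c → Balanced g v A B P
  chain-balanced (upPath p up)       minimal = upPath-balanced p up minimal
  chain-balanced (upCycle c up)      minimal = upCycle-balanced c up minimal
  chain-balanced (downPath p down)   minimal = swap (upPath-balanced p down minimal)
  chain-balanced (downCycle c down)  minimal = swap (upCycle-balanced c down minimal)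
  chain-balanced (oneWay one-way)    _       = oneWay-balanced one-way

module _ (g : Graph) {r : V g} (D : ChainDecomp g r) (v : V g) where
  open Graph g
  open ChainDecomp D

  -- below (toℕ i) and above (toℕ i) are H i and Hbar i by definition; exactly (toℕ i) is Gi i by does-≟.
  below exactly above : ℕ → EdgeSet g
  below   n e = toℕ (part e) <ᵇ n
  exactly n e = toℕ (part e) ≡ᵇ n
  above   n e = n <ᵇ toℕ (part e)

  deg-below-suc : ∀ n → deg g (below (suc n)) v ≡ deg g (below n) v + deg g (exactly n) v
  deg-below-suc n = deg-partition g v λ e → if-<ᵇ-suc (toℕ (part e)) n (mult g e v)

  deg-split : ∀ n → deg g (λ _ → true) v ≡ deg g (below (suc n)) v + deg g (above n) v
  deg-split n = deg-partition g v λ e → if-<ᵇ-suc-or-> (toℕ (part e)) n (mult g e v)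

  degreeProfile : Profile m
  degreeProfile = record
    { before      = λ n → deg g (below n) v
    ; at          = λ n → deg g (exactly n) v
    ; after       = λ n → deg g (above n) v
    ; total       = deg g (λ _ → true) v
    ; split       = λ {n} _ → trans (deg-split n) (cong (_+ deg g (above n) v) (deg-below-suc n))
    ; before-zero = sumFin-zero g {f = degTerm g (below 0) v} λ _ → refl
    ; before-suc  = λ {n} _ → deg-below-suc n
    ; after-last  = sumFin-zero g λ e →
                      cong (λ b → if b then mult g e v else 0) (<ᵇ-false (toℕ≤pred[n] (part e)))
    }

  open Profile degreeProfile

  deg-Gi : ∀ i → deg g (Gi i) v ≡ at (toℕ i)
  deg-Gi i = deg-cong g v λ e → does-≟ (part e) i

  degreeProfile-occupied : NoIsolated g → Occupied
  degreeProfile-occupied no-isolated with no-isolated v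
  ... | e , inc = toℕ (part e) , toℕ≤pred[n] (part e) ,
    subst (0 <_) (deg-Gi (part e))
      (InV⇒deg-pos g (Gi (part e)) v (e , dec-true (part e ≟ part e) refl , inc))

  module _ (minimal : IsMinimal g r D) (v≢r : v ≢ r) where
    private
      balanced : ∀ i → Balanced g v (H i) (Hbar i) (Gi i)
      balanced i = chain-balanced g r v v≢r (chain i) (minimal i)

    degreeProfile-forward : Forward
    degreeProfile-forward = ∀≤-fromFin λ i →
      subst (λ p → Admissible (before (toℕ i)) p (after (toℕ i))) (deg-Gi i) (proj₁ (balanced i))

    degreeProfile-backward : Backward
    degreeProfile-backward = ∀≤-fromFin λ i →
      subst (λ p → Admissible (after (toℕ i)) p (before (toℕ i))) (deg-Gi i) (proj₂ (balanced i))

lemma8 : (g : Graph) → NoIsolated g → (r : V g) → (D : ChainDecomp g r) → IsMinimal g r D →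
    (v : V g) → v ≢ r →
    ∃[ i ] ∃[ j ] (deg g (ChainDecomp.H D i) v ≡ 2 × deg g (ChainDecomp.Hbar D j) v ≡ 2)
lemma8 g no-isolated r D minimal v v≢r =
  let (i , Hᵢ≡2) = ∃≤-toFin (reaches-two forward occupied)
      (j , H̄ⱼ≡2) = ∃≤-toFin (leaves-two π backward occupied)
  in  i , j , Hᵢ≡2 , H̄ⱼ≡2
  where
  π : Profile (ChainDecomp.m D)
  π = degreeProfile g D v
  open Profile π
  forward : Forward
  forward = degreeProfile-forward g D v minimal v≢r
  backward : Backward
  backward = degreeProfile-backward g D v minimal v≢r
  occupied : Occupied
  occupied = degreeProfile-occupied g D v no-isolated
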